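{- Let $\mathcal{S}$ be a well-formed signature, $\Gamma$ a well-formed context ($\mathcal{S}\vdash\Gamma\ \mathrm{ctx}$), and $M$ an extended nameless LF term (a refinement problem) such that a solution $(\rho,R)$ for $M$ exists, i.e. $\mathcal{S};\Gamma\vdash(\rho,R)(M):B$ for some type $B$. Then the refinement rules for terms and types construct a goal $G$ and an extended type $A$ such that $\mathcal{S};\Gamma;M\vdash(G\mid A)$ is derivable.
   Context: Nameless LF: kinds $L ::= \mathrm{type}\mid\Pi A.L$; types $A ::= \alpha\mid A\,M\mid\Pi A.B$; terms $M ::= c\mid\iota\mid\lambda A.M\mid M\,N$, where $c$ ranges over term constants, $\alpha$ over type constants, $\iota$ over de Bruijn indices (built from $0$ and successor $\sigma$); signatures are lists of declarations $c:A$ and $\alpha:L$; contexts are lists of types $\Gamma ::= \cdot\mid\Gamma,A$. Extended nameless LF adds type-level metavariables $?_A,?_B,\dots$ as types and term-level metavariables $?_a,?_b,\dots$ as terms; in goals also kind-level metavariables $?_L$ may occur as kinds. $\uparrow X$ is shifting of de Bruijn indices, $X[N/0]$ substitution for index $0$. The well-formedness judgements $\vdash\mathcal{S}\ \mathrm{sig}$, $\mathcal{S}\vdash\Gamma\ \mathrm{ctx}$, $\mathcal{S};\Gamma\vdash M:A$ are those of LF in nameless form (Harper–Pfenning style with algorithmic equality): in particular $c:A\in\mathcal{S}$ gives $\Gamma\vdash c:A$; $\Gamma,A\vdash 0:\uparrow A$; $\Gamma\vdash\iota:A$ gives $\Gamma,B\vdash\sigma\iota:\uparrow A$; $\Gamma\vdash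 A:\mathrm{type}$ and $\Gamma,A\vdash M:B$ give $\Gamma\vdash\lambda A.M:\Pi A.B$; $\Gamma\vdash M:\Pi A.B$, $\Gamma\vdash N:A'$ with $A,A'$ algorithmically equal give $\Gamma\vdash M\,N:B[N/0]$; analogous rules for types and kinds; none of these rules has metavariables, so well-formed objects contain none. A refinement is a pair $(\rho,R)$ with $\rho$ mapping term-level metavariables to extended terms and $R$ mapping type-level metavariables to extended types; $(\rho,R)(X)$ replaces each $?_a$ by $\rho(?_a)$ and each $?_A$ by $R(?_A)$ homomorphically. A solution of $M$ is a refinement with $(\rho,R)(M)$ a well-formed term. Goals: atoms are $\top$, $\mathit{term}(M,A,\Gamma)$, $\mathit{type}(A,L,\Gamma)$, $\mathit{eq}_T(A,A',L,\Gamma)$, $\mathit{eq}_K(L,L',\Gamma)$, $\mathit{shift}(A,A')$ (meaning $\uparrow A\equiv A'$) and $\mathit{subst}(B,N,B')$ (meaning $B[N/0]\equiv B'$); a goal is a conjunction of atoms, each optionally tagged by a goal variable, written $?_a : At$. Metavariables are treated as logic variables. Refinement judgements $\mathcal{S};\Gamma;M\vdash(G\mid A)$ and $\mathcal{S};\Gamma;A\vdash(G\mid L)$ are given by the following rules; metavariables appearing only in the conclusion are required to be fresh. (r-con) if $c:A\in\mathcal{S}$ then $\mathcal{S};\Gamma;c\vdash(\top\mid A)$. (r-t-meta) $\mathcal{S};\Gamma;?_a\vdash(?_a:\mathit{term}(?_{a'},?_A,\Gamma)\mid ?_A)$. (r-zero) $\mathcal{S};\Gamma,A;0\vdash(\mathit{shift}(A,?_A)\mid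 ?_A)$. (r-succ) if $\mathcal{S};\Gamma;\iota\vdash(G\mid A)$ then $\mathcal{S};\Gamma,B;\sigma\iota\vdash(G\wedge\mathit{shift}(A,?_A)\mid ?_A)$. (r-$\lambda$-intro) if $\mathcal{S};\Gamma;A\vdash(G_A\mid L)$ and $\mathcal{S};\Gamma,A;M\vdash(G_M\mid B)$ then $\mathcal{S};\Gamma;\lambda A.M\vdash(G_A\wedge G_M\wedge\mathit{eq}_K(L,\mathrm{type},\Gamma)\mid\Pi A.B)$. (r-$\lambda$-elim) if $\mathcal{S};\Gamma;M\vdash(G_M\mid A)$ and $\mathcal{S};\Gamma;N\vdash(G_N\mid A_2)$ then $\mathcal{S};\Gamma;M\,N\vdash(G_M\wedge G_N\wedge\mathit{eq}_T(A,\Pi A_2.?_B,\mathrm{type},\Gamma)\wedge\mathit{subst}(?_B,N,?_{B'})\mid ?_{B'})$. (r-tcon) if $\alpha:L\in\mathcal{S}$ then $\mathcal{S};\Gamma;\alpha\vdash(\top\mid L)$. (r-T-meta) $\mathcal{S};\Gamma;?_A\vdash(\mathit{type}(?_A,?_L,\Gamma)\mid ?_L)$. (r-$\Pi$-intro) if $\mathcal{S};\Gamma;A\vdash(G_A\mid L_1)$ and $\mathcal{S};\Gamma,A;B\vdash(G_B\mid L_2)$ then $\mathcal{S};\Gamma;\Pi A.B\vdash(G_A\wedge G_B\wedge\mathit{eq}_K(L_1,\mathrm{type},\Gamma)\wedge\mathit{eq}_K(L_2,\mathrm{type},\Gamma)\mid\mathrm{type})$. (r-$\Pi$-elim) if $\mathcal{S};\Gamma;A\vdash(G_A\mid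 L)$ and $\mathcal{S};\Gamma;M\vdash(G_M\mid B)$ then $\mathcal{S};\Gamma;A\,M\vdash(G_A\wedge G_M\wedge\mathit{eq}_K(L,\Pi B.?_L,\Gamma)\wedge\mathit{subst}(?_L,M,?_{L'})\mid ?_{L'})$. -}

module Defs where

open import Data.Nat using (ℕ; zero; suc; _⊔_)
open import Data.List using (List; []; _∷_; map)
open import Data.List.Membership.Propositional using (_∈_)
open import Data.Product using (∃)
open import Relation.Nullary using (¬_)

-- Term constants and type constants are named by natural numbers
-- (two separate name spaces).  De Bruijn indices are natural numbers
-- (0 and successor σ = suc).
-- Well-formed (non-extended) objects are those in which no metavariable
-- occurs; the typing judgements below have no rules for metavariables.

mutual
  data Kind : Set where
    type  : Kind
    Πk    : Ty → Kind → Kind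
    kmeta : ℕ → Kind            -- kind-level metavariable ?_L (goals only)

  data Ty : Set where
    tcon  : ℕ → Ty
    tapp  : Ty → Tm → Ty
    Π     : Ty → Ty → Ty
    tmeta : ℕ → Ty

  data Tm : Set where
    con  : ℕ → Tm
    var  : ℕ → Tm
    lam  : Ty → Tm → Tm
    app  : Tm → Tm → Tm
    meta : ℕ → Tm

-- Signature declarations; a signature is a list, most recent first.
data Decl : Set where
  tmDecl : ℕ → Ty → Decl
  tyDecl : ℕ → Kind → Decl

Sig : Set
Sig = List Decl

-- Contexts: list of types, the head is the most recent entry (index 0).
-- Γ , A  is  A ∷ Γ.
Ctx : Set
Ctx = List Ty

-- Shifting (with cutoff) and substitution.  Metavariables are left alone
-- (they never occur in well-formed objects).

shiftVar : ℕ → ℕ → ℕ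
shiftVar zero    i       = suc i
shiftVar (suc c) zero    = zero
shiftVar (suc c) (suc i) = suc (shiftVar c i)

mutual
  shiftTm : ℕ → Tm → Tm
  shiftTm c (con x)   = con x
  shiftTm c (var i)   = var (shiftVar c i)
  shiftTm c (lam A M) = lam (shiftTy c A) (shiftTm (suc c) M)
  shiftTm c (app M N) = app (shiftTm c M) (shiftTm c N)
  shiftTm c (meta a)  = meta a

  shiftTy : ℕ → Ty → Ty
  shiftTy c (tcon α)   = tcon α
  shiftTy c (tapp A M) = tapp (shiftTy c A) (shiftTm c M)
  shiftTy c (Π A B)    = Π (shiftTy c A) (shiftTy (suc c) B)
  shiftTy c (tmeta x)  = tmeta x

↑Tm : Tm → Tm
↑Tm = shiftTm 0

↑Ty : Ty → Ty
↑Ty = shiftTy 0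

-- X[N/k] for a variable index: index k is replaced by (↑^k N),
-- indices above k are decremented.
substVar : ℕ → Tm → ℕ → Tm
substVar zero    N zero    = N
substVar zero    N (suc i) = var i
substVar (suc k) N zero    = var zero
substVar (suc k) N (suc i) = shiftTm 0 (substVar k N i)

mutual
  substTm : ℕ → Tm → Tm → Tm
  substTm k N (con x)   = con x
  substTm k N (var i)   = substVar k N i
  substTm k N (lam A M) = lam (substTy k N A) (substTm (suc k) N M)
  substTm k N (app M P) = app (substTm k N M) (substTm k N P)
  substTm k N (meta a)  = meta a

  substTy : ℕ → Tm → Ty → Ty
  substTy k N (tcon α)   = tcon α
  substTy k N (tapp A M) = tapp (substTy k N A) (substTm k N M)
  substTy k N (Π A B)    = Π (substTy k N A) (substTy (suc k) N B)
  substTy k N (tmeta x)  = tmeta x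

substK : ℕ → Tm → Kind → Kind
substK k N type      = type
substK k N (Πk A L)  = Πk (substTy k N A) (substK (suc k) N L)
substK k N (kmeta x) = kmeta x

-- Harper–Pfenning algorithmic equality (nameless form).

data SType : Set where
  base : ℕ → SType
  _⇒_  : SType → SType → SType

data SKind : Set where
  stype : SKind
  _⇛_   : SType → SKind → SKind

-- erasure to simple types (metavariables erase to junk; irrelevant since
-- the equality rules never relate metavariables)
eraseTy : Ty → SType
eraseTy (tcon α)   = base α
eraseTy (tapp A M) = eraseTy A
eraseTy (Π A B)    = eraseTy A ⇒ eraseTy B
eraseTy (tmeta x)  = base 0

eraseK : Kind → SKind
eraseK type      = stype
eraseK (Πk A L)  = eraseTy A ⇛ eraseK L
eraseK (kmeta x) = stype

eraseCtx : Ctx → List SType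
eraseCtx = map eraseTy

data Lookup {X : Set} : List X → ℕ → X → Set where
  here  : ∀ {x xs} → Lookup (x ∷ xs) zero x
  there : ∀ {x y xs i} → Lookup xs i x → Lookup (y ∷ xs) (suc i) x

data Whr : Tm → Tm → Set where
  whr-β   : ∀ {A M N} → Whr (app (lam A M) N) (substTm 0 N M)
  whr-app : ∀ {M M' N} → Whr M M' → Whr (app M N) (app M' N)

mutual
  data AlgEqTm (S : Sig) : List SType → Tm → Tm → SType → Set where
    ae-whrL : ∀ {Δ M M' N a} → Whr M M' → AlgEqTm S Δ M' N (base a)
            → AlgEqTm S Δ M N (base a)
    ae-whrR : ∀ {Δ M N N' a} → Whr N N' → AlgEqTm S Δ M N' (base a)
            → AlgEqTm S Δ M N (base a)
    ae-str  : ∀ {Δ M N a} → StrEqTm S Δ M N (base a)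
            → AlgEqTm S Δ M N (base a)
    ae-ext  : ∀ {Δ M N τ₁ τ₂}
            → AlgEqTm S (τ₁ ∷ Δ) (app (↑Tm M) (var 0)) (app (↑Tm N) (var 0)) τ₂
            → AlgEqTm S Δ M N (τ₁ ⇒ τ₂)

  data StrEqTm (S : Sig) : List SType → Tm → Tm → SType → Set where
    se-var : ∀ {Δ i τ} → Lookup Δ i τ → StrEqTm S Δ (var i) (var i) τ
    se-con : ∀ {Δ c A} → tmDecl c A ∈ S → StrEqTm S Δ (con c) (con c) (eraseTy A)
    se-app : ∀ {Δ M₁ N₁ M₂ N₂ τ₂ τ}
           → StrEqTm S Δ M₁ N₁ (τ₂ ⇒ τ) → AlgEqTm S Δ M₂ N₂ τ₂
           → StrEqTm S Δ (app M₁ M₂) (app N₁ N₂) τ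

data StrEqTy (S : Sig) : List SType → Ty → Ty → SKind → Set where
  st-con : ∀ {Δ α L} → tyDecl α L ∈ S → StrEqTy S Δ (tcon α) (tcon α) (eraseK L)
  st-app : ∀ {Δ A₁ A₂ M₁ M₂ τ κ}
         → StrEqTy S Δ A₁ A₂ (τ ⇛ κ) → AlgEqTm S Δ M₁ M₂ τ
         → StrEqTy S Δ (tapp A₁ M₁) (tapp A₂ M₂) κ

data AlgEqTy (S : Sig) : List SType → Ty → Ty → Set where
  at-str : ∀ {Δ A B} → StrEqTy S Δ A B stype → AlgEqTy S Δ A B
  at-Π   : ∀ {Δ A₁ A₂ B₁ B₂}
         → AlgEqTy S Δ A₁ B₁ → AlgEqTy S (eraseTy A₁ ∷ Δ) A₂ B₂
         → AlgEqTy S Δ (Π A₁ A₂) (Π B₁ B₂)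

mutual
  data TmOf (S : Sig) : Ctx → Tm → Ty → Set where
    t-con  : ∀ {Γ c A} → tmDecl c A ∈ S → TmOf S Γ (con c) A
    t-zero : ∀ {Γ A} → TmOf S (A ∷ Γ) (var 0) (↑Ty A)
    t-succ : ∀ {Γ i A B} → TmOf S Γ (var i) A → TmOf S (B ∷ Γ) (var (suc i)) (↑Ty A)
    t-lam  : ∀ {Γ A M B} → TyOf S Γ A type → TmOf S (A ∷ Γ) M B
           → TmOf S Γ (lam A M) (Π A B)
    t-app  : ∀ {Γ M N A A' B} → TmOf S Γ M (Π A B) → TmOf S Γ N A'
           → AlgEqTy S (eraseCtx Γ) A A'
           → TmOf S Γ (app M N) (substTy 0 N B)

  data TyOf (S : Sig) : Ctx → Ty → Kind → Set where
    k-con : ∀ {Γ α L} → tyDecl α L ∈ S → TyOf S Γ (tcon α) L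
    k-app : ∀ {Γ A M B B' L} → TyOf S Γ A (Πk B L) → TmOf S Γ M B'
          → AlgEqTy S (eraseCtx Γ) B B'
          → TyOf S Γ (tapp A M) (substK 0 M L)
    k-Π   : ∀ {Γ A B} → TyOf S Γ A type → TyOf S (A ∷ Γ) B type
          → TyOf S Γ (Π A B) type

data KindOK (S : Sig) : Ctx → Kind → Set where
  kd-type : ∀ {Γ} → KindOK S Γ type
  kd-Π    : ∀ {Γ A L} → TyOf S Γ A type → KindOK S (A ∷ Γ) L → KindOK S Γ (Πk A L)

data SigOK : Sig → Set where
  sig-nil : SigOK []
  sig-tm  : ∀ {S c A} → SigOK S → TyOf S [] A type
          → ¬ (∃ λ B → tmDecl c B ∈ S) → SigOK (tmDecl c A ∷ S)
  sig-ty  : ∀ {S α L} → SigOK S → KindOK S [] L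
          → ¬ (∃ λ K → tyDecl α K ∈ S) → SigOK (tyDecl α L ∷ S)

data CtxOK (S : Sig) : Ctx → Set where
  ctx-nil  : CtxOK S []
  ctx-cons : ∀ {Γ A} → CtxOK S Γ → TyOf S Γ A type → CtxOK S (A ∷ Γ)

mutual
  refineTm : (ℕ → Tm) → (ℕ → Ty) → Tm → Tm
  refineTm ρ R (con c)   = con c
  refineTm ρ R (var i)   = var i
  refineTm ρ R (lam A M) = lam (refineTy ρ R A) (refineTm ρ R M)
  refineTm ρ R (app M N) = app (refineTm ρ R M) (refineTm ρ R N)
  refineTm ρ R (meta a)  = ρ a

  refineTy : (ℕ → Tm) → (ℕ → Ty) → Ty → Ty
  refineTy ρ R (tcon α)   = tcon α
  refineTy ρ R (tapp A M) = tapp (refineTy ρ R A) (refineTm ρ R M)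
  refineTy ρ R (Π A B)    = Π (refineTy ρ R A) (refineTy ρ R B)
  refineTy ρ R (tmeta x)  = R x

mutual
  mvBoundTm : Tm → ℕ
  mvBoundTm (con c)   = 0
  mvBoundTm (var i)   = 0
  mvBoundTm (lam A M) = mvBoundTy A ⊔ mvBoundTm M
  mvBoundTm (app M N) = mvBoundTm M ⊔ mvBoundTm N
  mvBoundTm (meta a)  = suc a

  mvBoundTy : Ty → ℕ
  mvBoundTy (tcon α)   = 0
  mvBoundTy (tapp A M) = mvBoundTy A ⊔ mvBoundTm M
  mvBoundTy (Π A B)    = mvBoundTy A ⊔ mvBoundTy B
  mvBoundTy (tmeta x)  = suc x

data Atom : Set where
  ⊤A     : Atom
  termA  : Tm → Ty → Ctx → Atom
  typeA  : Ty → Kind → Ctx → Atom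
  eqTA   : Ty → Ty → Kind → Ctx → Atom
  eqKA   : Kind → Kind → Ctx → Atom
  shiftA : Ty → Ty → Atom
  substA : Ty → Tm → Ty → Atom
  substKA : Kind → Tm → Kind → Atom

infixr 4 _∧_
data Goal : Set where
  atom   : Atom → Goal
  tagged : ℕ → Atom → Goal
  _∧_    : Goal → Goal → Goal

-- Freshness is made explicit by a name supply: RefTm S Γ M n n' G A means
-- the derivation uses exactly the metavariable names n, n+1, …, n'-1 as
-- its fresh metavariables (one shared supply for term/type/kind metas),
-- allocated left to right.

mutual
  data RefTm (S : Sig) : Ctx → Tm → ℕ → ℕ → Goal → Ty → Set where
    r-con    : ∀ {Γ c A n} → tmDecl c A ∈ S
             → RefTm S Γ (con c) n n (atom ⊤A) A
    r-t-meta : ∀ {Γ a n}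
             → RefTm S Γ (meta a) n (suc (suc n))
                 (tagged a (termA (meta n) (tmeta (suc n)) Γ)) (tmeta (suc n))
    r-zero   : ∀ {Γ A n}
             → RefTm S (A ∷ Γ) (var 0) n (suc n) (atom (shiftA A (tmeta n))) (tmeta n)
    r-succ   : ∀ {Γ B i n n₁ G A}
             → RefTm S Γ (var i) n n₁ G A
             → RefTm S (B ∷ Γ) (var (suc i)) n (suc n₁)
                 (G ∧ atom (shiftA A (tmeta n₁))) (tmeta n₁)
    r-λ-intro : ∀ {Γ A M n n₁ n₂ GA L GM B}
             → RefTy S Γ A n n₁ GA L
             → RefTm S (A ∷ Γ) M n₁ n₂ GM B
             → RefTm S Γ (lam A M) n n₂ (GA ∧ GM ∧ atom (eqKA L type Γ)) (Π A B)
    r-λ-elim : ∀ {Γ M N n n₁ n₂ GM A GN A₂}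
             → RefTm S Γ M n n₁ GM A
             → RefTm S Γ N n₁ n₂ GN A₂
             → RefTm S Γ (app M N) n (suc (suc n₂))
                 (GM ∧ GN ∧ atom (eqTA A (Π A₂ (tmeta n₂)) type Γ)
                         ∧ atom (substA (tmeta n₂) N (tmeta (suc n₂))))
                 (tmeta (suc n₂))

  data RefTy (S : Sig) : Ctx → Ty → ℕ → ℕ → Goal → Kind → Set where
    r-tcon   : ∀ {Γ α L n} → tyDecl α L ∈ S
             → RefTy S Γ (tcon α) n n (atom ⊤A) L
    r-T-meta : ∀ {Γ a n}
             → RefTy S Γ (tmeta a) n (suc n) (atom (typeA (tmeta a) (kmeta n) Γ)) (kmeta n)
    r-Π-intro : ∀ {Γ A B n n₁ n₂ GA L₁ GB L₂}
             → RefTy S Γ A n n₁ GA L₁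
             → RefTy S (A ∷ Γ) B n₁ n₂ GB L₂
             → RefTy S Γ (Π A B) n n₂
                 (GA ∧ GB ∧ atom (eqKA L₁ type Γ) ∧ atom (eqKA L₂ type Γ)) type
    r-Π-elim : ∀ {Γ A M n n₁ n₂ GA L GM B}
             → RefTy S Γ A n n₁ GA L
             → RefTm S Γ M n₁ n₂ GM B
             → RefTy S Γ (tapp A M) n (suc (suc n₂))
                 (GA ∧ GM ∧ atom (eqKA L (Πk B (kmeta n₂)) Γ)
                         ∧ atom (substKA (kmeta n₂) M (kmeta (suc n₂))))
                 (kmeta (suc n₂))

module Submission where

-- The refinement rules are syntax-directed and never inspect the types they
-- produce: each rule only requires that its immediate subobjects can be
-- refined, plus two side conditions, namely that a constant is declared in
-- S and that a de Bruijn index lies in scope.  A typing derivation of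
-- (ρ , R)(M) supplies exactly these side conditions.  Refining changes the
-- types stored in a context (λ A. M is typed in (ρ , R)(A) ∷ Γ but refined in
-- A ∷ Γ), so the induction relates the refinement context Γ to the typing
-- context Γ' only through length Γ ≡ length Γ'.

open import Defs
open import Data.Nat using (ℕ; zero; suc; _≤_; _<_; z≤n; s≤s)
open import Data.Product using (∃-syntax; _,_)
open import Data.List using (_∷_; length)
open import Relation.Binary.PropositionalEquality using (_≡_; refl; sym; cong; subst)

Refinable : Sig → Ctx → Tm → ℕ → Set
Refinable S Γ M n = ∃[ n' ] ∃[ G ] ∃[ A ] RefTm S Γ M n n' G A

RefinableTy : Sig → Ctx → Ty → ℕ → Set
RefinableTy S Γ A n = ∃[ n' ] ∃[ G ] ∃[ L ] RefTy S Γ A n n' G L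

varRefinable : ∀ {S} (Γ : Ctx) (i n : ℕ) → i < length Γ → Refinable S Γ (var i) n
varRefinable (A ∷ Γ) zero    n _ = _ , _ , _ , r-zero
varRefinable (B ∷ Γ) (suc i) n (s≤s i<Γ) with varRefinable Γ i n i<Γ
... | _ , _ , _ , r = _ , _ , _ , r-succ r

varInScope : ∀ {S Γ i B} → TmOf S Γ (var i) B → i < length Γ
varInScope t-zero     = s≤s z≤n
varInScope (t-succ d) = s≤s (varInScope d)

mutual
  tmRefinable : ∀ {S Γ Γ' ρ R B} (M : Tm) → length Γ ≡ length Γ'
              → TmOf S Γ' (refineTm ρ R M) B → (n : ℕ) → Refinable S Γ M n
  tmRefinable (con c) _ (t-con c∈S) n = _ , _ , _ , r-con c∈S
  tmRefinable {Γ = Γ} (var i) |Γ| d n =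
    varRefinable Γ i n (subst (i <_) (sym |Γ|) (varInScope d))
  tmRefinable (lam A M) |Γ| (t-lam dA dM) n with tyRefinable A |Γ| dA n
  ... | n₁ , _ , _ , rA with tmRefinable M (cong suc |Γ|) dM n₁
  ... | _ , _ , _ , rM = _ , _ , _ , r-λ-intro rA rM
  tmRefinable (app M N) |Γ| (t-app dM dN _) n with tmRefinable M |Γ| dM n
  ... | n₁ , _ , _ , rM with tmRefinable N |Γ| dN n₁
  ... | _ , _ , _ , rN = _ , _ , _ , r-λ-elim rM rN
  tmRefinable (meta a) _ _ n = _ , _ , _ , r-t-meta

  tyRefinable : ∀ {S Γ Γ' ρ R L} (A : Ty) → length Γ ≡ length Γ'
              → TyOf S Γ' (refineTy ρ R A) L → (n : ℕ) → RefinableTy S Γ A n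
  tyRefinable (tcon α) _ (k-con α∈S) n = _ , _ , _ , r-tcon α∈S
  tyRefinable (tapp A M) |Γ| (k-app dA dM _) n with tyRefinable A |Γ| dA n
  ... | n₁ , _ , _ , rA with tmRefinable M |Γ| dM n₁
  ... | _ , _ , _ , rM = _ , _ , _ , r-Π-elim rA rM
  tyRefinable (Π A B) |Γ| (k-Π dA dB) n with tyRefinable A |Γ| dA n
  ... | n₁ , _ , _ , rA with tyRefinable B (cong suc |Γ|) dB n₁
  ... | _ , _ , _ , rB = _ , _ , _ , r-Π-intro rA rB
  tyRefinable (tmeta x) _ _ n = _ , _ , _ , r-T-meta

mainTheorem2 : (S : Sig) (Γ : Ctx) (M : Tm)
    → SigOK S → CtxOK S Γ
    → (∃[ ρ ] ∃[ R ] ∃[ B ] TmOf S Γ (refineTm ρ R M) B)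
    → (n : ℕ) → mvBoundTm M ≤ n
    → ∃[ n' ] ∃[ G ] ∃[ A ] RefTm S Γ M n n' G A
mainTheorem2 S Γ M _ _ (ρ , R , B , typed) n _ = tmRefinable M refl typed n
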